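{- Let $R$ be an oriented ray and let $D$ be a digraph obtained by the following construction. Let $I:=\{(n,m)\in\mathbb N^2: n\le m\}$ and let $(R(n,m))_{(n,m)\in I}$ be pairwise vertex-disjoint copies of $R$, with $D_{ -1}:=\bigcup_{(n,m)\in I}R(n,m)$. Let $J:=\{((n^0,m^0),(n^1,m^1))\in I^2: m^0<m^1\}$ and let $((n_i^0,m_i^0),(n_i^1,m_i^1))_{i\in\mathbb N}$ be a sequence in $J$ containing every element of $J$ infinitely often. Let $(g_i^0,g_i^1)_{i\in\mathbb N}$ be a sequence of pairs of vertices of $D_{ -1}$, where all the vertices $g_i^\varepsilon$ ($i\in\mathbb N$, $\varepsilon\in\{0,1\}$) are pairwise distinct, with $g_i^0\in R(n_i^0,m_i^0)$ and $g_i^1\in R(n_i^1,m_i^1)$ for all $i$. Let $D$ be obtained from $D_{ -1}$ by identifying $g_i^0$ with $g_i^1$ for every $i\in\mathbb N$, and for $(n,m)\in I$ let $R(n,m)$ also denote the ray in $D$ with the same arc set. Then $D$ contains $k$ pairwise vertex-disjoint copies of $R$ for every $k\in\mathbb N$. Moreover, if every copy of $R$ in $D$ has a tail that coincides with a tail of $R(n,m)$ for some $(n,m)\in I$, then $D$ does not contain infinitely many pairwise vertex-disjoint copies of $R$; in particular, $R$ is then not ubiquitous.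
   Context: An oriented ray is a digraph whose underlying undirected graph is a ray (one-way infinite path); a tail of a ray is a subray obtained by deleting a finite initial segment. A copy of $R$ in $D$ is a subdigraph of $D$ isomorphic to $R$. A digraph $H$ is ubiquitous if every digraph which, for every $k\in\mathbb N$, contains $k$ pairwise vertex-disjoint copies of $H$ also contains infinitely many pairwise vertex-disjoint copies of $H$. -}

module Defs where

open import Data.Nat using (ℕ; zero; suc; _+_; _≤_; _<_)
open import Data.Bool using (Bool; true; false; if_then_else_)
open import Data.Fin using (Fin)
open import Data.Product using (Σ; Σ-syntax; ∃; ∃-syntax; _×_; _,_; proj₁; proj₂)
open import Data.Sum using (_⊎_)
open import Relation.Binary.PropositionalEquality using (_≡_; _≢_)
open import Relation.Nullary using (¬_)

record Digraph : Set₁ where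
  field
    V    : Set
    A    : Set
    tail : A → V
    head : A → V
open Digraph public

-- An oriented ray R is determined by the orientation of each edge of the
-- underlying ray 0 - 1 - 2 - ... : (o j ≡ true) means the edge {j, j+1} is
-- the arc j → j+1, (o j ≡ false) means it is the arc j+1 → j.
Orientation : Set
Orientation = ℕ → Bool

rsrc : Orientation → ℕ → ℕ
rsrc o j = if o j then j else suc j

rtgt : Orientation → ℕ → ℕ
rtgt o j = if o j then suc j else j

rayDigraph : Orientation → Digraph
rayDigraph o = record { V = ℕ ; A = ℕ ; tail = rsrc o ; head = rtgt o }

-- A copy of R in D: a subdigraph of D isomorphic to R, given by the
-- isomorphism, i.e. an injective vertex map together with, for each arc j
-- of R, an arc of D with the corresponding tail and head.
record Copy (o : Orientation) (D : Digraph) : Set where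
  field
    vmap    : ℕ → V D
    vinj    : ∀ a b → vmap a ≡ vmap b → a ≡ b
    amap    : ℕ → A D
    amap-tl : ∀ j → tail D (amap j) ≡ vmap (rsrc o j)
    amap-hd : ∀ j → head D (amap j) ≡ vmap (rtgt o j)
open Copy public

Disjoint : ∀ {o D} → Copy o D → Copy o D → Set
Disjoint c d = ∀ a b → vmap c a ≢ vmap d b

HasKDisjointCopies : Orientation → Digraph → ℕ → Set
HasKDisjointCopies o D k =
  Σ[ c ∈ (Fin k → Copy o D) ] (∀ x y → x ≢ y → Disjoint (c x) (c y))

HasInfDisjointCopies : Orientation → Digraph → Set
HasInfDisjointCopies o D =
  Σ[ c ∈ (ℕ → Copy o D) ] (∀ x y → x ≢ y → Disjoint (c x) (c y))

Ubiquitous : Orientation → Set₁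
Ubiquitous o = (D : Digraph) → (∀ k → HasKDisjointCopies o D k) → HasInfDisjointCopies o D

Idx : Set
Idx = Σ[ n ∈ ℕ ] Σ[ m ∈ ℕ ] n ≤ m

idx-m : Idx → ℕ
idx-m (n , m , _) = m

JIdx : Set
JIdx = Σ[ p ∈ Idx ] Σ[ q ∈ Idx ] idx-m p < idx-m q

-- the ε-component of an element of J (false ↦ 0, true ↦ 1)
jcomp : JIdx → Bool → Idx
jcomp (p , q , _) false = p
jcomp (p , q , _) true  = q

InfinitelyOften : (ℕ → JIdx) → Set
InfinitelyOften s = ∀ x N → ∃[ i ] (N ≤ i × s i ≡ x)

-- D₋₁ = disjoint union of the copies R(n,m), (n,m) ∈ I:
-- vertex (p , t) is vertex t of R(p), arc (p , j) is arc j of R(p).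
D₋₁ : Orientation → Digraph
D₋₁ o = record
  { V    = Idx × ℕ
  ; A    = Idx × ℕ
  ; tail = λ { (p , j) → (p , rsrc o j) }
  ; head = λ { (p , j) → (p , rtgt o j) }
  }

-- π : V(D₋₁) → W realises exactly the identification of g i false with
-- g i true for every i (and nothing else).
IdentifiesExactly : (g : ℕ → Bool → Idx × ℕ) {W : Set} → (Idx × ℕ → W) → Set
IdentifiesExactly g π =
  ∀ u v → (π u ≡ π v) →
    (u ≡ v ⊎ ∃[ i ] ((u ≡ g i false × v ≡ g i true) ⊎ (u ≡ g i true × v ≡ g i false)))

Identifies : (g : ℕ → Bool → Idx × ℕ) {W : Set} → (Idx × ℕ → W) → Set
Identifies g π = ∀ i → π (g i false) ≡ π (g i true)

SurjectiveMap : {X Y : Set} → (X → Y) → Set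
SurjectiveMap {X} {Y} f = ∀ (y : Y) → ∃[ x ] (f x ≡ y)

-- D = D₋₁ with vertices identified along π (surjective, identifying exactly
-- the pairs g i false, g i true); arcs are those of D₋₁, so the arc (p , j)
-- of D is the j-th arc of the ray R(p) in D.
quotientD : Orientation → (W : Set) → (Idx × ℕ → W) → Digraph
quotientD o W π = record
  { V    = W
  ; A    = Idx × ℕ
  ; tail = λ a → π (tail (D₋₁ o) a)
  ; head = λ a → π (head (D₋₁ o) a)
  }

-- every copy of R in D has a tail coinciding with a tail of some R(n,m)
-- (two tails of rays coincide iff their arc sequences agree from some point)
EveryCopyEndsInSomeR : Orientation → (W : Set) → (Idx × ℕ → W) → Set
EveryCopyEndsInSomeR o W π =
  (c : Copy o (quotientD o W π)) →
    ∃[ p ] ∃[ s ] ∃[ t ] (∀ j → amap c (s + j) ≡ (p , t + j))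

{-# OPTIONS --safe #-}
module Submission where

-- For a fixed m the rays R(n,m), n ≤ m, stay pairwise disjoint in D, because
-- gluing only ever joins rays of different levels m⁰ < m¹; this gives k disjoint
-- copies for every k. Conversely, each pair of rays R(p), R(q) on levels
-- m⁰ < m¹ is glued infinitely often at pairwise distinct vertices, hence
-- arbitrarily far out on both rays, so two copies ending in R(p) and R(q)
-- always meet. Two copies ending in the same ray meet as well, so infinitely
-- many disjoint copies would end in distinct rays of a single level m, of which
-- there are only m + 1.

open import Defs
open import Data.Nat using (ℕ; zero; suc; _+_; _≤_; _<_; _≤?_; s≤s)
open import Data.Nat.Properties
  using (≤-refl; ≤-trans; <-trans; <⇒≤; <⇒≢; <⇒≱; ≰⇒>; m≤m+n; m≤n+m; ≤-irrelevant;
         m≤n⇒m<n∨m≡n; m≤n⇒∃[o]m+o≡n; <-cmp; _≟_; 1+n≰n)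
open import Data.Bool using (Bool; true; false)
open import Data.Fin using (Fin; toℕ; fromℕ<; join; splitAt)
open import Data.Fin.Properties
  using (toℕ-injective; toℕ<n; fromℕ<-injective; splitAt-join; injective⇒≤; any?)
open import Data.Product using (_×_; _,_; proj₁; proj₂; ∃-syntax)
open import Data.Sum using (_⊎_; inj₁; inj₂)
open import Data.Sum.Properties using (inj₁-injective; inj₂-injective)
open import Data.Empty using (⊥-elim)
open import Function using (_∘_)
open import Function.Definitions using (Injective)
open import Relation.Binary.PropositionalEquality
open import Relation.Binary.Definitions using (tri<; tri≈; tri>)
open import Relation.Nullary using (¬_; yes; no)
open import Relation.Nullary.Decidable using (_×-dec_)

arc-endpoint : ∀ o j → rsrc o j ≡ j ⊎ rtgt o j ≡ j
arc-endpoint o j with o j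
... | true  = inj₁ refl
... | false = inj₂ refl

injective-pair-jointly-≥ : ∀ {n} T (a b : Fin n → ℕ) → Injective _≡_ _≡_ a → Injective _≡_ _≡_ b →
             T + T < n → ∃[ k ] (T ≤ a k × T ≤ b k)
injective-pair-jointly-≥ {n} T a b a-inj b-inj T+T<n with any? (λ k → (T ≤? a k) ×-dec (T ≤? b k))
... | yes found = found
... | no none = ⊥-elim (<⇒≱ T+T<n (injective⇒≤ encode-injective))
  where
  -- Each k has a k < T or b k < T; recording that value injects Fin n into Fin T ⊎ Fin T.
  small : ∀ k → a k < T ⊎ b k < T
  small k with T ≤? a k | T ≤? b k
  ... | no T≰a  | _       = inj₁ (≰⇒> T≰a)
  ... | yes _   | no T≰b  = inj₂ (≰⇒> T≰b)
  ... | yes T≤a | yes T≤b = ⊥-elim (none (k , T≤a , T≤b))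

  join-injective : ∀ x y → join T T x ≡ join T T y → x ≡ y
  join-injective x y eq =
    trans (sym (splitAt-join T T x)) (trans (cong (splitAt T) eq) (splitAt-join T T y))

  encode : ∀ {k} → a k < T ⊎ b k < T → Fin (T + T)
  encode (inj₁ a<T) = join T T (inj₁ (fromℕ< a<T))
  encode (inj₂ b<T) = join T T (inj₂ (fromℕ< b<T))

  encode-injective′ : ∀ {k k′} (u : a k < T ⊎ b k < T) (v : a k′ < T ⊎ b k′ < T) →
                      encode u ≡ encode v → k ≡ k′
  encode-injective′ (inj₁ a<T) (inj₁ a′<T) eq =
    a-inj (fromℕ<-injective _ _ a<T a′<T (inj₁-injective (join-injective _ _ eq)))
  encode-injective′ (inj₂ b<T) (inj₂ b′<T) eq =
    b-inj (fromℕ<-injective _ _ b<T b′<T (inj₂-injective (join-injective _ _ eq)))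
  encode-injective′ (inj₁ a<T) (inj₂ b′<T) eq
    with () ← join-injective (inj₁ (fromℕ< a<T)) (inj₂ (fromℕ< b′<T)) eq
  encode-injective′ (inj₂ b<T) (inj₁ a′<T) eq
    with () ← join-injective (inj₂ (fromℕ< b<T)) (inj₁ (fromℕ< a′<T)) eq

  encode-injective : Injective _≡_ _≡_ (λ k → encode (small k))
  encode-injective {k} {k′} = encode-injective′ (small k) (small k′)

module Enumerate {P : ℕ → Set} (often : ∀ N → ∃[ i ] (N ≤ i × P i)) where

  enum : ℕ → ℕ
  enum zero    = proj₁ (often 0)
  enum (suc k) = proj₁ (often (suc (enum k)))

  enum-satisfies : ∀ k → P (enum k)
  enum-satisfies zero    = proj₂ (proj₂ (often 0))
  enum-satisfies (suc k) = proj₂ (proj₂ (often (suc (enum k))))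

  enum-step : ∀ k → enum k < enum (suc k)
  enum-step k = proj₁ (proj₂ (often (suc (enum k))))

  enum-strictly-increasing : ∀ {k k′} → k < k′ → enum k < enum k′
  enum-strictly-increasing {k} {suc k′} (s≤s k≤k′) with m≤n⇒m<n∨m≡n k≤k′
  ... | inj₁ k<k′ = <-trans (enum-strictly-increasing k<k′) (enum-step k′)
  ... | inj₂ refl = enum-step k

  enum-injective : Injective _≡_ _≡_ enum
  enum-injective {k} {k′} eq with <-cmp k k′
  ... | tri< k<k′ _ _ = ⊥-elim (<⇒≢ (enum-strictly-increasing k<k′) eq)
  ... | tri≈ _ k≡k′ _ = k≡k′
  ... | tri> _ _ k′<k = ⊥-elim (<⇒≢ (enum-strictly-increasing k′<k) (sym eq))

Idx-≡ : ∀ {p q : Idx} → proj₁ p ≡ proj₁ q → idx-m p ≡ idx-m q → p ≡ q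
Idx-≡ {n , m , n≤m} {.n , .m , n≤m′} refl refl = cong (λ l → n , m , l) (≤-irrelevant n≤m n≤m′)

jcomp-level< : ∀ z → idx-m (jcomp z false) < idx-m (jcomp z true)
jcomp-level< (p , q , m⁰<m¹) = m⁰<m¹

level-capacity : ∀ {n M} (f : Fin n → Idx) → Injective _≡_ _≡_ f →
                 (∀ x → idx-m (f x) ≡ M) → n ≤ suc M
level-capacity {n} {M} f f-inj on-level = injective⇒≤ first-injective
  where
  first : Fin n → Fin (suc M)
  first x = fromℕ< (s≤s (subst (proj₁ (f x) ≤_) (on-level x) (proj₂ (proj₂ (f x)))))

  first-injective : Injective _≡_ _≡_ first
  first-injective {x} {y} eq =
    f-inj (Idx-≡ (fromℕ<-injective _ _ _ _ eq) (trans (on-level x) (sym (on-level y))))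

module Construction
  (o : Orientation) (s : ℕ → JIdx) (io : InfinitelyOften s)
  (g : ℕ → Bool → Idx × ℕ)
  (g-ray : ∀ i ε → proj₁ (g i ε) ≡ jcomp (s i) ε)
  (g-injective : ∀ i ε j δ → g i ε ≡ g j δ → (i ≡ j × ε ≡ δ))
  (W : Set) (π : Idx × ℕ → W) (π-glues : Identifies g π) (π-exact : IdentifiesExactly g π)
  where

  D : Digraph
  D = quotientD o W π

  level : Idx × ℕ → ℕ
  level u = idx-m (proj₁ u)

  g-on-ray : ∀ {i z} → s i ≡ z → ∀ ε → g i ε ≡ (jcomp z ε , proj₂ (g i ε))
  g-on-ray {i} refl ε = cong (_, proj₂ (g i ε)) (g-ray i ε)

  g-levels-differ : ∀ i → level (g i false) < level (g i true)
  g-levels-differ i =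
    subst₂ (λ p q → idx-m p < idx-m q) (sym (g-ray i false)) (sym (g-ray i true)) (jcomp-level< (s i))

  g-position-injective : ∀ {i i′} ε → s i ≡ s i′ → proj₂ (g i ε) ≡ proj₂ (g i′ ε) → i ≡ i′
  g-position-injective {i} {i′} ε same-pair same-position =
    proj₁ (g-injective i ε i′ ε
      (trans (g-on-ray same-pair ε)
        (trans (cong (jcomp (s i′) ε ,_) same-position) (sym (g-on-ray refl ε)))))

  π-injective-on-levels : ∀ u v → level u ≡ level v → π u ≡ π v → u ≡ v
  π-injective-on-levels u v same-level eq with π-exact u v eq
  ... | inj₁ u≡v = u≡v
  ... | inj₂ (i , inj₁ (refl , refl)) = ⊥-elim (<⇒≢ (g-levels-differ i) same-level)
  ... | inj₂ (i , inj₂ (refl , refl)) = ⊥-elim (<⇒≢ (g-levels-differ i) (sym same-level))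

  R : Idx → Copy o D
  R p = record
    { vmap    = λ t → π (p , t)
    ; vinj    = λ a b eq → cong proj₂ (π-injective-on-levels (p , a) (p , b) refl eq)
    ; amap    = λ j → p , j
    ; amap-tl = λ j → refl
    ; amap-hd = λ j → refl
    }

  R-disjoint : ∀ {p q} → p ≢ q → idx-m p ≡ idx-m q → Disjoint (R p) (R q)
  R-disjoint p≢q same-level a b eq =
    p≢q (cong proj₁ (π-injective-on-levels (_ , a) (_ , b) same-level eq))

  disjoint-rays : ∀ k → HasKDisjointCopies o D k
  disjoint-rays k = R ∘ ray , λ x y x≢y → R-disjoint (x≢y ∘ toℕ-injective ∘ cong proj₁) refl
    where
    ray : Fin k → Idx
    ray x = toℕ x , k , <⇒≤ (toℕ<n x)

  Follows : Copy o D → Idx → ℕ → ℕ → Set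
  Follows c p s t = ∀ j → amap c (s + j) ≡ (p , t + j)

  EndsIn : Copy o D → Idx → Set
  EndsIn c p = ∃[ s ] ∃[ t ] Follows c p s t

  follows-covers : ∀ c {p s t a} → Follows c p s t → t ≤ a → ∃[ α ] vmap c α ≡ π (p , a)
  follows-covers c {p} {s} {t} follows t≤a with m≤n⇒∃[o]m+o≡n t≤a
  ... | j , refl with arc-endpoint o (t + j)
  ... | inj₁ src≡ = rsrc o (s + j) , (begin
          vmap c (rsrc o (s + j))   ≡⟨ sym (amap-tl c (s + j)) ⟩
          tail D (amap c (s + j))   ≡⟨ cong (tail D) (follows j) ⟩
          π (p , rsrc o (t + j))    ≡⟨ cong (π ∘ (p ,_)) src≡ ⟩
          π (p , t + j)             ∎)
    where open ≡-Reasoning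
  ... | inj₂ tgt≡ = rtgt o (s + j) , (begin
          vmap c (rtgt o (s + j))   ≡⟨ sym (amap-hd c (s + j)) ⟩
          head D (amap c (s + j))   ≡⟨ cong (head D) (follows j) ⟩
          π (p , rtgt o (t + j))    ≡⟨ cong (π ∘ (p ,_)) tgt≡ ⟩
          π (p , t + j)             ∎)
    where open ≡-Reasoning

  gluing-beyond : ∀ z T → ∃[ i ] (s i ≡ z × T ≤ proj₂ (g i false) × T ≤ proj₂ (g i true))
  gluing-beyond z T =
    let k , T≤g₀ , T≤g₁ = large in enum (toℕ k) , enum-satisfies (toℕ k) , T≤g₀ , T≤g₁
    where
    open Enumerate (io z)

    position : Bool → Fin (suc (T + T)) → ℕ
    position ε k = proj₂ (g (enum (toℕ k)) ε)

    position-injective : ∀ ε → Injective _≡_ _≡_ (position ε)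
    position-injective ε {x} {y} eq = toℕ-injective (enum-injective
      (g-position-injective ε (trans (enum-satisfies (toℕ x)) (sym (enum-satisfies (toℕ y)))) eq))

    large : ∃[ k ] (T ≤ position false k × T ≤ position true k)
    large = injective-pair-jointly-≥ T (position false) (position true)
              (position-injective false) (position-injective true) ≤-refl

  ends-on-different-levels-meet : ∀ c d {p q} → EndsIn c p → EndsIn d q →
                                  idx-m p < idx-m q → ¬ Disjoint c d
  ends-on-different-levels-meet c d {p} {q} (_ , tc , c-follows) (_ , td , d-follows) p<q c#d =
    let i , s-i , T≤g₀ , T≤g₁ = gluing-beyond (p , q , p<q) (tc + td)
        α , cα = follows-covers c c-follows (≤-trans (m≤m+n tc td) T≤g₀)
        β , dβ = follows-covers d d-follows (≤-trans (m≤n+m td tc) T≤g₁)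
    in c#d α β (begin
         vmap c α      ≡⟨ cα ⟩
         π (p , _)     ≡⟨ cong π (sym (g-on-ray s-i false)) ⟩
         π (g i false) ≡⟨ π-glues i ⟩
         π (g i true)  ≡⟨ cong π (g-on-ray s-i true) ⟩
         π (q , _)     ≡⟨ sym dβ ⟩
         vmap d β      ∎)
    where open ≡-Reasoning

  ends-on-same-ray-meet : ∀ c d {p} → EndsIn c p → EndsIn d p → ¬ Disjoint c d
  ends-on-same-ray-meet c d (_ , tc , c-follows) (_ , td , d-follows) c#d =
    let α , cα = follows-covers c c-follows (m≤m+n tc td)
        β , dβ = follows-covers d d-follows (m≤n+m td tc)
    in c#d α β (trans cα (sym dβ))

  no-infinitely-many-disjoint-copies : EveryCopyEndsInSomeR o W π → ¬ HasInfDisjointCopies o D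
  no-infinitely-many-disjoint-copies ends (c , c#) =
    1+n≰n (level-capacity (ray ∘ toℕ) (toℕ-injective ∘ ray-injective) (λ x → same-level (toℕ x) 0))
    where
    ray : ℕ → Idx
    ray x = proj₁ (ends (c x))

    ends-in-ray : ∀ x → EndsIn (c x) (ray x)
    ends-in-ray x = proj₂ (ends (c x))

    same-level : ∀ x y → idx-m (ray x) ≡ idx-m (ray y)
    same-level x y with x ≟ y
    ... | yes refl = refl
    ... | no x≢y with <-cmp (idx-m (ray x)) (idx-m (ray y))
    ... | tri< lt _ _ = ⊥-elim (ends-on-different-levels-meet (c x) (c y)
                          (ends-in-ray x) (ends-in-ray y) lt (c# x y x≢y))
    ... | tri≈ _ eq _ = eq
    ... | tri> _ _ gt = ⊥-elim (ends-on-different-levels-meet (c y) (c x)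
                          (ends-in-ray y) (ends-in-ray x) gt (c# y x (x≢y ∘ sym)))

    ray-injective : Injective _≡_ _≡_ ray
    ray-injective {x} {y} eq with x ≟ y
    ... | yes x≡y = x≡y
    ... | no x≢y  = ⊥-elim (ends-on-same-ray-meet (c x) (c y) (ends-in-ray x)
                      (subst (EndsIn (c y)) (sym eq) (ends-in-ray y)) (c# x y x≢y))

proposition4p1 : (o : Orientation) (s : ℕ → JIdx) → InfinitelyOften s →
    (g : ℕ → Bool → Idx × ℕ) →
    (∀ i ε → proj₁ (g i ε) ≡ jcomp (s i) ε) →
    (∀ i ε j δ → g i ε ≡ g j δ → (i ≡ j × ε ≡ δ)) →
    (W : Set) (π : Idx × ℕ → W) → SurjectiveMap π → Identifies g π →
    IdentifiesExactly g π →
    ((k : ℕ) → HasKDisjointCopies o (quotientD o W π) k) ×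
    (EveryCopyEndsInSomeR o W π →
      ¬ HasInfDisjointCopies o (quotientD o W π) × ¬ Ubiquitous o)
proposition4p1 o s io g g-ray g-injective W π _ π-glues π-exact =
  disjoint-rays , λ ends →
    no-infinitely-many-disjoint-copies ends ,
    λ ubiquitous → no-infinitely-many-disjoint-copies ends (ubiquitous D disjoint-rays)
  where open Construction o s io g g-ray g-injective W π π-glues π-exact
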